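{- For integers $a, b$, there do not exist both an even $m \geq 0$ and an odd $m' \geq 0$ with $(s(m), s(m+1)) = (a,b)$ and $(s(m'), s(m'+1)) = (a,b)$. That is, no pair of consecutive values occurs in the infinity series beginning at both an even and an odd position.
   Context: The infinity series $(s(n))_{n \geq 0}$ is the integer sequence defined by $s(0)=0$, $s(2n) = -s(n)$ for $n \geq 1$, and $s(2n+1) = s(n)+1$ for $n \geq 0$. -}

module Defs where

open import Data.Bool using (Bool; true; false)
open import Data.Nat using (ℕ; zero; suc; ⌊_/2⌋)
open import Data.Integer using (ℤ; +_; -_; _+_)

odd : ℕ → Bool
odd zero          = false
odd (suc zero)    = true
odd (suc (suc n)) = odd n

-- sF fuel n : the infinity series s(n), computed with fuel (correct whenever n ≤ fuel).
-- Recursion: s(0) = 0, s(2k) = - s(k) (k ≥ 1), s(2k+1) = s(k) + 1,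
-- where for n ≥ 1, k = ⌊ n /2⌋ and parity decides which rule applies.
sF : ℕ → ℕ → ℤ
sF _       zero    = + 0
sF zero    (suc n) = + 0
sF (suc f) (suc n) with odd (suc n)
... | true  = sF f ⌊ suc n /2⌋ + + 1
... | false = - sF f ⌊ suc n /2⌋

s : ℕ → ℤ
s n = sF n n

-- With δ k = s (k+1) − s k and σ k = −1 − (s k + s (k+1)), the defining recurrences give
--   δ (2j) = 1 + 2 s j,   σ (2j) = −2,   δ (2j+1) = σ j,   σ (2j+1) = δ j − 2,
-- so by induction along k ↦ ⌊k/2⌋ neither δ k nor σ k is ever a non-negative even integer.
-- A pair (a, b) at an even position has a + b = 1, i.e. σ = −2; at the odd position 2k'+1
-- this forces δ k' = 0, which is non-negative and even.
module Submission where

open import Defs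
open import Data.Nat using (ℕ; _*_; _+_)
open import Data.Integer using (ℤ)
open import Data.Product using (_×_; Σ)
open import Relation.Nullary using (¬_)
open import Relation.Binary.PropositionalEquality using (_≡_)

open import Data.Bool using (true; false)
open import Data.Nat as ℕ using (zero; suc; ⌊_/2⌋; _≤_; _<_; s≤s)
open import Data.Nat.Properties as ℕP using (*-suc; +-comm; +-identityʳ)
open import Data.Nat.Induction using (<-rec)
open import Data.Integer as ℤ using (+_; -[1+_]; -_; _-_)
open import Data.Integer.Properties using (+-injective)
open import Data.Integer.Tactic.RingSolver using (solve-∀)
open import Data.Product using (_,_; proj₁)
open import Function using (_∘_)
open import Relation.Binary.PropositionalEquality
  using (refl; sym; trans; cong; cong₂; subst; module ≡-Reasoning)
open ≡-Reasoning

sF-fuel-irrelevant : ∀ {f g n} → n ≤ f → n ≤ g → sF f n ≡ sF g n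
sF-fuel-irrelevant {n = zero} _ _ = refl
sF-fuel-irrelevant {suc f} {suc g} {suc n} (s≤s n≤f) (s≤s n≤g)
  with odd (suc n) | sF-fuel-irrelevant (half≤ n≤f) (half≤ n≤g)
  where half≤ : ∀ {h} → n ≤ h → ⌊ suc n /2⌋ ≤ h
        half≤ = ℕP.≤-trans (ℕP.⌈n/2⌉≤n n)
... | true  | eq = cong (ℤ._+ + 1) eq
... | false | eq = cong -_ eq

s-suc-odd : ∀ n → odd (suc n) ≡ true → s (suc n) ≡ s ⌊ suc n /2⌋ ℤ.+ + 1
s-suc-odd n odd-n rewrite odd-n =
  cong (ℤ._+ + 1) (sF-fuel-irrelevant (ℕP.⌈n/2⌉≤n n) ℕP.≤-refl)

s-suc-even : ∀ n → odd (suc n) ≡ false → s (suc n) ≡ - s ⌊ suc n /2⌋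
s-suc-even n even-n rewrite even-n =
  cong -_ (sF-fuel-irrelevant (ℕP.⌈n/2⌉≤n n) ℕP.≤-refl)

odd-double : ∀ j → odd (2 * j) ≡ false
odd-double zero = refl
odd-double (suc j) rewrite *-suc 2 j = odd-double j

odd-suc-double : ∀ j → odd (suc (2 * j)) ≡ true
odd-suc-double zero = refl
odd-suc-double (suc j) = subst (λ m → odd (suc m) ≡ true) (sym (*-suc 2 j)) (odd-suc-double j)

⌊double/2⌋ : ∀ j → ⌊ 2 * j /2⌋ ≡ j
⌊double/2⌋ zero = refl
⌊double/2⌋ (suc j) rewrite *-suc 2 j = cong suc (⌊double/2⌋ j)

⌊suc-double/2⌋ : ∀ j → ⌊ suc (2 * j) /2⌋ ≡ j
⌊suc-double/2⌋ zero = refl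
⌊suc-double/2⌋ (suc j) = subst (λ m → ⌊ suc m /2⌋ ≡ suc j) (sym (*-suc 2 j)) (cong suc (⌊suc-double/2⌋ j))

s-double : ∀ j → s (2 * j) ≡ - s j
s-double zero = refl
s-double (suc j) = begin
  s (2 * suc j)          ≡⟨ s-suc-even (ℕ.pred (2 * suc j)) (odd-double (suc j)) ⟩
  - s ⌊ 2 * suc j /2⌋    ≡⟨ cong (-_ ∘ s) (⌊double/2⌋ (suc j)) ⟩
  - s (suc j)            ∎

s-suc-double : ∀ j → s (suc (2 * j)) ≡ s j ℤ.+ + 1
s-suc-double j = begin
  s (suc (2 * j))              ≡⟨ s-suc-odd (2 * j) (odd-suc-double j) ⟩
  s ⌊ suc (2 * j) /2⌋ ℤ.+ + 1  ≡⟨ cong (λ i → s i ℤ.+ + 1) (⌊suc-double/2⌋ j) ⟩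
  s j ℤ.+ + 1                  ∎

s-suc-suc-double : ∀ j → s (suc (suc (2 * j))) ≡ - s (suc j)
s-suc-suc-double j = trans (cong s (sym (*-suc 2 j))) (s-double (suc j))

δ : ℕ → ℤ
δ k = s (suc k) - s k

σ : ℕ → ℤ
σ k = - + 1 - (s k ℤ.+ s (suc k))

δ-double : ∀ j → δ (2 * j) ≡ + 1 ℤ.+ (s j ℤ.+ s j)
δ-double j = begin
  s (suc (2 * j)) - s (2 * j)   ≡⟨ cong₂ _-_ (s-suc-double j) (s-double j) ⟩
  (s j ℤ.+ + 1) - (- s j)       ≡⟨ ring (s j) ⟩
  + 1 ℤ.+ (s j ℤ.+ s j)         ∎
  where ring : ∀ x → (x ℤ.+ + 1) - (- x) ≡ + 1 ℤ.+ (x ℤ.+ x)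
        ring = solve-∀

σ-double : ∀ j → σ (2 * j) ≡ - + 2
σ-double j = begin
  - + 1 - (s (2 * j) ℤ.+ s (suc (2 * j)))  ≡⟨ cong (λ x → - + 1 - x) (cong₂ ℤ._+_ (s-double j) (s-suc-double j)) ⟩
  - + 1 - (- s j ℤ.+ (s j ℤ.+ + 1))        ≡⟨ ring (s j) ⟩
  - + 2                                     ∎
  where ring : ∀ x → - + 1 - (- x ℤ.+ (x ℤ.+ + 1)) ≡ - + 2
        ring = solve-∀

δ-suc-double : ∀ j → δ (suc (2 * j)) ≡ σ j
δ-suc-double j = begin
  s (suc (suc (2 * j))) - s (suc (2 * j))  ≡⟨ cong₂ _-_ (s-suc-suc-double j) (s-suc-double j) ⟩
  - s (suc j) - (s j ℤ.+ + 1)              ≡⟨ ring (s j) (s (suc j)) ⟩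
  σ j                                       ∎
  where ring : ∀ x y → - y - (x ℤ.+ + 1) ≡ - + 1 - (x ℤ.+ y)
        ring = solve-∀

σ-suc-double : ∀ j → σ (suc (2 * j)) ℤ.+ + 2 ≡ δ j
σ-suc-double j = begin
  - + 1 - (s (suc (2 * j)) ℤ.+ s (suc (suc (2 * j)))) ℤ.+ + 2  ≡⟨ cong (λ x → - + 1 - x ℤ.+ + 2)
                                                                   (cong₂ ℤ._+_ (s-suc-double j) (s-suc-suc-double j)) ⟩
  - + 1 - ((s j ℤ.+ + 1) ℤ.+ - s (suc j)) ℤ.+ + 2              ≡⟨ ring (s j) (s (suc j)) ⟩
  s (suc j) - s j                                              ∎
  where ring : ∀ x y → - + 1 - ((x ℤ.+ + 1) ℤ.+ - y) ℤ.+ + 2 ≡ y - x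
        ring = solve-∀

NonNegEven : ℤ → Set
NonNegEven z = Σ ℕ λ n → z ≡ + (2 * n)

¬nonNegEven-odd : ∀ z → ¬ NonNegEven (+ 1 ℤ.+ (z ℤ.+ z))
¬nonNegEven-odd (+ m)    (n , eq) =
  ℕP.even≢odd n m (trans (sym (+-injective eq)) (cong (λ k → suc (m + k)) (sym (+-identityʳ m))))
¬nonNegEven-odd -[1+ m ] (n , ())

¬nonNegEven-neg : ¬ NonNegEven (- + 2)
¬nonNegEven-neg (n , ())

nonNegEven-+2 : ∀ {z} → NonNegEven z → NonNegEven (z ℤ.+ + 2)
nonNegEven-+2 (n , refl) = suc n , cong +_ (trans (+-comm (2 * n) 2) (sym (*-suc 2 n)))

NeitherNonNegEven : ℕ → Set
NeitherNonNegEven k = ¬ NonNegEven (δ k) × ¬ NonNegEven (σ k)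

neitherNonNegEven-double : ∀ j → NeitherNonNegEven (2 * j)
neitherNonNegEven-double j =
    (λ e → ¬nonNegEven-odd (s j) (subst NonNegEven (δ-double j) e))
  , (λ e → ¬nonNegEven-neg (subst NonNegEven (σ-double j) e))

neitherNonNegEven-suc-double : ∀ j → NeitherNonNegEven j → NeitherNonNegEven (suc (2 * j))
neitherNonNegEven-suc-double j (¬δ , ¬σ) =
    (λ e → ¬σ (subst NonNegEven (δ-suc-double j) e))
  , (λ e → ¬δ (subst NonNegEven (σ-suc-double j) (nonNegEven-+2 e)))

data Parity : ℕ → Set where
  double     : ∀ j → Parity (2 * j)
  suc-double : ∀ j → Parity (suc (2 * j))

parity : ∀ k → Parity k
parity zero = double 0
parity (suc k) with parity k
... | double j     = suc-double j
... | suc-double j = subst Parity (*-suc 2 j) (double (suc j))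

neitherNonNegEven : ∀ k → NeitherNonNegEven k
neitherNonNegEven = <-rec NeitherNonNegEven step
  where
  step : ∀ k → (∀ {j} → j < k → NeitherNonNegEven j) → NeitherNonNegEven k
  step k rec with parity k
  ... | double j     = neitherNonNegEven-double j
  ... | suc-double j = neitherNonNegEven-suc-double j (rec (s≤s (ℕP.m≤m+n j (j + 0))))

corollary8 : (a b : ℤ) →
    ¬ ((Σ ℕ λ k → s (2 * k) ≡ a × s (2 * k + 1) ≡ b) ×
       (Σ ℕ λ k → s (2 * k + 1) ≡ a × s (2 * k + 1 + 1) ≡ b))
corollary8 a b ((k , s₀≡a , s₁≡b) , (k' , s₀'≡a , s₁'≡b)) =
  proj₁ (neitherNonNegEven k') (0 , δk'≡0)
  where
  σ-of : ℤ → ℤ → ℤ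
  σ-of x y = - + 1 - (x ℤ.+ y)

  odd-position : ∀ j → 2 * j + 1 ≡ suc (2 * j)
  odd-position j = +-comm (2 * j) 1

  after-odd-position : ∀ j → 2 * j + 1 + 1 ≡ suc (suc (2 * j))
  after-odd-position j = trans (+-comm (2 * j + 1) 1) (cong suc (odd-position j))

  σ-agree : σ (2 * k) ≡ σ (suc (2 * k'))
  σ-agree = begin
    σ (2 * k)          ≡⟨ cong₂ σ-of s₀≡a (trans (cong s (sym (odd-position k))) s₁≡b) ⟩
    σ-of a b           ≡⟨ sym (cong₂ σ-of (trans (cong s (sym (odd-position k'))) s₀'≡a)
                                          (trans (cong s (sym (after-odd-position k'))) s₁'≡b)) ⟩
    σ (suc (2 * k'))   ∎

  δk'≡0 : δ k' ≡ + 0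
  δk'≡0 = begin
    δ k'                      ≡⟨ sym (σ-suc-double k') ⟩
    σ (suc (2 * k')) ℤ.+ + 2  ≡⟨ cong (ℤ._+ + 2) (sym σ-agree) ⟩
    σ (2 * k) ℤ.+ + 2         ≡⟨ cong (ℤ._+ + 2) (σ-double k) ⟩
    + 0                       ∎
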